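{- For every positive integer $n$ there is a subset $S$ of the vertices of $Q_n$ with the following two properties: (i) every vertex of $Q_n$ is either in $S$ or adjacent to a member of $S$; (ii) every vertex of $Q_n$ is adjacent to at most $2$ vertices in $S$.
   Context: $Q_n$ denotes the $n$-dimensional hypercube graph: its vertex set is $\{0,1\}^n$, and two vertices are adjacent if and only if they differ in exactly one coordinate. -}

module Defs where

open import Data.Bool using (Bool; true; false; if_then_else_)
open import Data.Nat using (ℕ; zero; suc; _+_)
open import Data.Vec using (Vec; []; _∷_)
open import Data.List using (List; []; _∷_; map; _++_; length; filter)
open import Relation.Binary.PropositionalEquality using (_≡_)
open import Relation.Nullary using (Dec; yes; no)
open import Data.Product using (Σ; ∃; _×_)
open import Data.Sum using (_⊎_)
open import Data.Nat using (_≤_; _≟_)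

Vertex : ℕ → Set
Vertex n = Vec Bool n

hamming : ∀ {n} → Vertex n → Vertex n → ℕ
hamming [] [] = 0
hamming (true ∷ u) (true ∷ v) = hamming u v
hamming (false ∷ u) (false ∷ v) = hamming u v
hamming (true ∷ u) (false ∷ v) = suc (hamming u v)
hamming (false ∷ u) (true ∷ v) = suc (hamming u v)

Adj : ∀ {n} → Vertex n → Vertex n → Set
Adj u v = hamming u v ≡ 1

adj? : ∀ {n} (u v : Vertex n) → Dec (Adj u v)
adj? u v = hamming u v ≟ 1

allVertices : (n : ℕ) → List (Vertex n)
allVertices zero = [] ∷ []
allVertices (suc n) = map (true ∷_) (allVertices n) ++ map (false ∷_) (allVertices n)

Subset : ℕ → Set
Subset n = Vertex n → Bool

_∈S_ : ∀ {n} → Vertex n → Subset n → Set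
v ∈S S = S v ≡ true

countAdjIn : ∀ {n} → Subset n → Vertex n → ℕ
countAdjIn {n} S v = length (filter (λ u → adj? v u) (filter (λ u → Data.Bool._≟_ (S u) true) (allVertices n)))
  where import Data.Bool

-- Choose k with 2^k ≤ n ≤ 2^(k+1) and label the n coordinate directions by
-- vectors l₁ … lₙ ∈ {0,1}^k so that every vector of {0,1}^k is used once or
-- twice.  The syndrome of a vertex u is σ(u) = Σ_{uᵢ = 1} lᵢ (sums mod 2), and
-- S is the set of vertices with syndrome 0.  Flipping coordinate i changes the
-- syndrome by lᵢ, so u ⊕ eᵢ ∈ S iff lᵢ = σ(u): the number of S-neighbours of u
-- is the multiplicity of σ(u) among the labels, which lies between 1 and 2.
module Submission where

open import Defs
open import Data.Nat using (ℕ; suc; _≤_)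
open import Data.Product using (Σ; ∃; _×_)
open import Data.Sum using (_⊎_)

open import Data.Nat using (zero; _+_; _^_; z≤n; s≤s; _≡ᵇ_)
open import Data.Nat.Properties
  using (+-comm; +-assoc; +-identityʳ; ≤-trans; ≤-reflexive; +-monoʳ-≤;
         m≤n+m; n≤1+n; m≤n⇒m≤1+n; m≤n⇒m<n∨m≡n; ≡ᵇ⇒≡; module ≤-Reasoning)
open import Data.Bool using (Bool; true; false; _∧_; not; _xor_; T)
open import Data.Bool.Properties using (∧-identityʳ; ∧-zeroʳ; xor-assoc; xor-comm; T-∧; T-≡)
import Data.Bool as Bool
open import Data.Vec using (Vec; []; _∷_; zipWith; replicate; toList)
open import Data.Vec.Properties using (zipWith-assoc; zipWith-comm)
open import Data.List using (List; []; _∷_; map; _++_; length; filter)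
open import Data.List.Properties using (length-++; length-map)
open import Data.Product using (_,_)
open import Data.Sum using (inj₁; inj₂)
open import Function using (_∘_)
open import Function.Bundles using (Equivalence)
open import Relation.Nullary using (does)
open import Relation.Unary using (Pred; Decidable)
open import Relation.Binary.PropositionalEquality
  using (_≡_; refl; sym; trans; cong; cong₂; subst; module ≡-Reasoning)
open import Level using (0ℓ)

[_] : Bool → ℕ
[ true ] = 1
[ false ] = 0

count : {A : Set} → (A → Bool) → List A → ℕ
count p [] = 0
count p (x ∷ xs) = [ p x ] + count p xs

count-++ : {A : Set} (p : A → Bool) (xs ys : List A) →
           count p (xs ++ ys) ≡ count p xs + count p ys
count-++ p [] ys = refl
count-++ p (x ∷ xs) ys =
  trans (cong ([ p x ] +_) (count-++ p xs ys)) (sym (+-assoc [ p x ] _ _))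

count-map : {A B : Set} (p : B → Bool) (f : A → B) (xs : List A) →
            count p (map f xs) ≡ count (p ∘ f) xs
count-map p f [] = refl
count-map p f (x ∷ xs) = cong ([ p (f x) ] +_) (count-map p f xs)

count-cong : {A : Set} {p q : A → Bool} → (∀ x → p x ≡ q x) →
             (xs : List A) → count p xs ≡ count q xs
count-cong p≡q [] = refl
count-cong p≡q (x ∷ xs) = cong₂ _+_ (cong [_] (p≡q x)) (count-cong p≡q xs)

count-none : {A : Set} {p : A → Bool} → (∀ x → p x ≡ false) →
             (xs : List A) → count p xs ≡ 0
count-none p≡false [] = refl
count-none p≡false (x ∷ xs) = cong₂ _+_ (cong [_] (p≡false x)) (count-none p≡false xs)

count-witness : {A : Set} (p : A → Bool) (xs : List A) →
                1 ≤ count p xs → ∃ λ x → T (p x)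
count-witness p (x ∷ xs) pos with p x in px
... | true = x , subst T (sym px) _
... | false = count-witness p xs pos

length-filter-filter :
  {A : Set} {P Q : Pred A 0ℓ} (P? : Decidable P) (Q? : Decidable Q) (xs : List A) →
  length (filter P? (filter Q? xs)) ≡ count (λ x → does (Q? x) ∧ does (P? x)) xs
length-filter-filter P? Q? [] = refl
length-filter-filter P? Q? (x ∷ xs) with does (Q? x)
... | false = length-filter-filter P? Q? xs
... | true with does (P? x)
...   | false = length-filter-filter P? Q? xs
...   | true = cong suc (length-filter-filter P? Q? xs)

_==_ : ∀ {n} → Vertex n → Vertex n → Bool
u == w = hamming u w ≡ᵇ 0

count-cube : ∀ {n} (p : Vertex (suc n) → Bool) →
             count p (allVertices (suc n)) ≡
             count (p ∘ (true ∷_)) (allVertices n) + count (p ∘ (false ∷_)) (allVertices n)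
count-cube {n} p =
  trans (count-++ p (map (true ∷_) (allVertices n)) _)
        (cong₂ _+_ (count-map p _ (allVertices n)) (count-map p _ (allVertices n)))

count-equal : ∀ {n} (P : Subset n) (v : Vertex n) →
              count (λ u → P u ∧ (v == u)) (allVertices n) ≡ [ P v ]
count-equal {zero} P [] = trans (+-identityʳ _) (cong [_] (∧-identityʳ (P [])))
count-equal {suc n} P (true ∷ v) = begin
  count (λ u → P u ∧ ((true ∷ v) == u)) (allVertices (suc n))
    ≡⟨ count-cube (λ u → P u ∧ ((true ∷ v) == u)) ⟩
  count (λ u → P (true ∷ u) ∧ (v == u)) (allVertices n)
    + count (λ u → P (false ∷ u) ∧ false) (allVertices n)
    ≡⟨ cong₂ _+_ (count-equal (P ∘ (true ∷_)) v)
                 (count-none (λ u → ∧-zeroʳ (P (false ∷ u))) (allVertices n)) ⟩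
  [ P (true ∷ v) ] + 0
    ≡⟨ +-identityʳ _ ⟩
  [ P (true ∷ v) ] ∎
  where open ≡-Reasoning
count-equal {suc n} P (false ∷ v) =
  trans (count-cube (λ u → P u ∧ ((false ∷ v) == u)))
        (cong₂ _+_ (count-none (λ u → ∧-zeroʳ (P (true ∷ u))) (allVertices n))
                   (count-equal (P ∘ (false ∷_)) v))

neighboursIn : ∀ {n} → Subset n → Vertex n → ℕ
neighboursIn {n} S v = count (λ u → S u ∧ does (adj? v u)) (allVertices n)

countAdjIn≡neighboursIn : ∀ {n} (S : Subset n) (v : Vertex n) →
                          countAdjIn S v ≡ neighboursIn S v
countAdjIn≡neighboursIn {n} S v =
  trans (length-filter-filter (adj? v) (λ u → S u Bool.≟ true) (allVertices n))
        (count-cong (λ u → cong (_∧ does (adj? v u)) (does-≟-true (S u))) (allVertices n))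
  where
  does-≟-true : ∀ b → does (b Bool.≟ true) ≡ b
  does-≟-true true = refl
  does-≟-true false = refl

neighboursIn-∷ : ∀ {n} (S : Subset (suc n)) (b : Bool) (v : Vertex n) →
                 neighboursIn S (b ∷ v) ≡ neighboursIn (S ∘ (b ∷_)) v + [ S (not b ∷ v) ]
neighboursIn-∷ {n} S true v =
  trans (count-cube (λ u → S u ∧ does (adj? (true ∷ v) u))) (cong (neighboursIn (S ∘ (true ∷_)) v +_) (count-equal (S ∘ (false ∷_)) v))
neighboursIn-∷ {n} S false v =
  trans (count-cube (λ u → S u ∧ does (adj? (false ∷ v) u)))
        (trans (cong (_+ neighboursIn (S ∘ (false ∷_)) v) (count-equal (S ∘ (true ∷_)) v))
               (+-comm [ S (true ∷ v) ] _))

_⊕_ : ∀ {k} → Vertex k → Vertex k → Vertex k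
_⊕_ = zipWith _xor_

0⃗ : ∀ {k} → Vertex k
0⃗ = replicate _ false

isZero : ∀ {k} → Vertex k → Bool
isZero w = w == 0⃗

weight-⊕ : ∀ {k} (w l : Vertex k) → hamming (w ⊕ l) 0⃗ ≡ hamming w l
weight-⊕ [] [] = refl
weight-⊕ (true ∷ w) (true ∷ l) = weight-⊕ w l
weight-⊕ (true ∷ w) (false ∷ l) = cong suc (weight-⊕ w l)
weight-⊕ (false ∷ w) (true ∷ l) = cong suc (weight-⊕ w l)
weight-⊕ (false ∷ w) (false ∷ l) = weight-⊕ w l

hamming-⊕ : ∀ {k} (w l : Vertex k) → hamming (w ⊕ l) l ≡ hamming w 0⃗
hamming-⊕ [] [] = refl
hamming-⊕ (true ∷ w) (true ∷ l) = cong suc (hamming-⊕ w l)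
hamming-⊕ (true ∷ w) (false ∷ l) = cong suc (hamming-⊕ w l)
hamming-⊕ (false ∷ w) (true ∷ l) = hamming-⊕ w l
hamming-⊕ (false ∷ w) (false ∷ l) = hamming-⊕ w l

syndrome : ∀ {k n} → Vec (Vertex k) n → Vertex k → Vertex n → Vertex k
syndrome [] t [] = t
syndrome (l ∷ L) t (true ∷ u) = syndrome L (t ⊕ l) u
syndrome (l ∷ L) t (false ∷ u) = syndrome L t u

syndrome-⊕ : ∀ {k n} (L : Vec (Vertex k) n) (t a : Vertex k) (u : Vertex n) →
             syndrome L (t ⊕ a) u ≡ syndrome L t u ⊕ a
syndrome-⊕ [] t a [] = refl
syndrome-⊕ (l ∷ L) t a (true ∷ u) = begin
  syndrome L ((t ⊕ a) ⊕ l) u ≡⟨ cong (λ x → syndrome L x u) swap ⟩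
  syndrome L ((t ⊕ l) ⊕ a) u ≡⟨ syndrome-⊕ L (t ⊕ l) a u ⟩
  syndrome L (t ⊕ l) u ⊕ a   ∎
  where
  open ≡-Reasoning
  swap : (t ⊕ a) ⊕ l ≡ (t ⊕ l) ⊕ a
  swap = begin
    (t ⊕ a) ⊕ l ≡⟨ zipWith-assoc xor-assoc t a l ⟩
    t ⊕ (a ⊕ l) ≡⟨ cong (t ⊕_) (zipWith-comm xor-comm a l) ⟩
    t ⊕ (l ⊕ a) ≡⟨ sym (zipWith-assoc xor-assoc t l a) ⟩
    (t ⊕ l) ⊕ a ∎
syndrome-⊕ (l ∷ L) t a (false ∷ u) = syndrome-⊕ L t a u

codewords : ∀ {k n} → Vec (Vertex k) n → Vertex k → Subset n
codewords L t u = isZero (syndrome L t u)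

multiplicity : ∀ {k n} → Vertex k → Vec (Vertex k) n → ℕ
multiplicity s L = count (s ==_) (toList L)

neighbours-codewords : ∀ {k n} (L : Vec (Vertex k) n) (t : Vertex k) (v : Vertex n) →
                       neighboursIn (codewords L t) v ≡ multiplicity (syndrome L t v) L
neighbours-codewords [] t [] = cong (λ b → [ b ] + 0) (∧-zeroʳ (isZero t))
neighbours-codewords (l ∷ L) t (true ∷ v) = begin
  neighboursIn (codewords (l ∷ L) t) (true ∷ v)
    ≡⟨ neighboursIn-∷ (codewords (l ∷ L) t) true v ⟩
  neighboursIn (codewords L (t ⊕ l)) v + [ isZero w ]
    ≡⟨ cong₂ _+_ (neighbours-codewords L (t ⊕ l) v) (cong [_] crossing) ⟩
  multiplicity w′ L + [ w′ == l ]
    ≡⟨ +-comm (multiplicity w′ L) _ ⟩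
  multiplicity w′ (l ∷ L) ∎
  where
  open ≡-Reasoning
  w = syndrome L t v
  w′ = syndrome L (t ⊕ l) v
  crossing : isZero w ≡ (w′ == l)
  crossing = sym (trans (cong (λ x → (x == l)) (syndrome-⊕ L t l v))
                        (cong (_≡ᵇ 0) (hamming-⊕ w l)))
neighbours-codewords (l ∷ L) t (false ∷ v) = begin
  neighboursIn (codewords (l ∷ L) t) (false ∷ v)
    ≡⟨ neighboursIn-∷ (codewords (l ∷ L) t) false v ⟩
  neighboursIn (codewords L t) v + [ isZero (syndrome L (t ⊕ l) v) ]
    ≡⟨ cong₂ _+_ (neighbours-codewords L t v) (cong [_] crossing) ⟩
  multiplicity w L + [ w == l ]
    ≡⟨ +-comm (multiplicity w L) _ ⟩
  multiplicity w (l ∷ L) ∎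
  where
  open ≡-Reasoning
  w = syndrome L t v
  crossing : isZero (syndrome L (t ⊕ l) v) ≡ (w == l)
  crossing = trans (cong isZero (syndrome-⊕ L t l v)) (cong (_≡ᵇ 0) (weight-⊕ w l))

codewords-dominate : ∀ {k n} (L : Vec (Vertex k) n) → (∀ s → 1 ≤ multiplicity s L) →
                     ∀ t v → ∃ λ u → u ∈S codewords L t × Adj v u
codewords-dominate {n = n} L occurs t v with
  count-witness (λ u → codewords L t u ∧ does (adj? v u)) (allVertices n)
    (subst (1 ≤_) (sym (neighbours-codewords L t v)) (occurs (syndrome L t v)))
... | u , inS∧adj with Equivalence.to T-∧ inS∧adj
...   | inS , adj = u , Equivalence.to T-≡ inS , ≡ᵇ⇒≡ (hamming v u) 1 adj

codewords-sparse : ∀ {k n} (L : Vec (Vertex k) n) → (∀ s → multiplicity s L ≤ 2) →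
                   ∀ t v → countAdjIn (codewords L t) v ≤ 2
codewords-sparse L twice t v =
  subst (_≤ 2) (sym (trans (countAdjIn≡neighboursIn (codewords L t) v)
                           (neighbours-codewords L t v)))
        (twice (syndrome L t v))

prefix : {A : Set} (n : ℕ) (xs : List A) → n ≤ length xs → Vec A n
prefix zero xs _ = []
prefix (suc n) (x ∷ xs) (s≤s n≤) = x ∷ prefix n xs n≤

count-prefix-≤ : {A : Set} (p : A → Bool) (n : ℕ) (xs : List A) (n≤ : n ≤ length xs) →
                 count p (toList (prefix n xs n≤)) ≤ count p xs
count-prefix-≤ p zero xs n≤ = z≤n
count-prefix-≤ p (suc n) (x ∷ xs) (s≤s n≤) = +-monoʳ-≤ [ p x ] (count-prefix-≤ p n xs n≤)

count-prefix-≥ : {A : Set} (p : A → Bool) (n : ℕ) (ys zs : List A)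
                 (n≤ : n ≤ length (ys ++ zs)) → length ys ≤ n →
                 count p ys ≤ count p (toList (prefix n (ys ++ zs) n≤))
count-prefix-≥ p n [] zs n≤ _ = z≤n
count-prefix-≥ p (suc n) (y ∷ ys) zs (s≤s n≤) (s≤s ys≤) =
  +-monoʳ-≤ [ p y ] (count-prefix-≥ p n ys zs n≤ ys≤)

2^suc : ∀ k → 2 ^ suc k ≡ 2 ^ k + 2 ^ k
2^suc k = cong (2 ^ k +_) (+-identityʳ (2 ^ k))

length-allVertices : ∀ k → length (allVertices k) ≡ 2 ^ k
length-allVertices zero = refl
length-allVertices (suc k) = begin
  length (map (true ∷_) (allVertices k) ++ map (false ∷_) (allVertices k))
    ≡⟨ length-++ (map (true ∷_) (allVertices k)) ⟩
  length (map (true ∷_) (allVertices k)) + length (map (false ∷_) (allVertices k))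
    ≡⟨ cong₂ _+_ (length-map _ (allVertices k)) (length-map _ (allVertices k)) ⟩
  length (allVertices k) + length (allVertices k)
    ≡⟨ cong₂ _+_ (length-allVertices k) (length-allVertices k) ⟩
  2 ^ k + 2 ^ k
    ≡⟨ sym (2^suc k) ⟩
  2 ^ suc k ∎
  where open ≡-Reasoning

-- For 2^k ≤ n ≤ 2^(k+1), the first n entries of the list of Q_k traversed
-- twice use every vector of {0,1}^k once or twice.
balanced-labelling : ∀ k n → 2 ^ k ≤ n → n ≤ 2 ^ suc k →
                     Σ (Vec (Vertex k) n) λ L →
                       (∀ s → 1 ≤ multiplicity s L) × (∀ s → multiplicity s L ≤ 2)
balanced-labelling k n lo hi = L , at-least-once , at-most-twice
  where
  A = allVertices k
  once : ∀ s → count (s ==_) A ≡ 1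
  once s = count-equal (λ _ → true) s
  fits : n ≤ length (A ++ A)
  fits = subst (n ≤_) (sym (trans (length-++ A) (trans (cong₂ _+_ (length-allVertices k)
                                                          (length-allVertices k))
                                                   (sym (2^suc k))))) hi
  L = prefix n (A ++ A) fits
  at-least-once : ∀ s → 1 ≤ multiplicity s L
  at-least-once s = subst (_≤ multiplicity s L) (once s)
    (count-prefix-≥ (s ==_) n A A fits (subst (_≤ n) (sym (length-allVertices k)) lo))
  at-most-twice : ∀ s → multiplicity s L ≤ 2
  at-most-twice s = ≤-trans (count-prefix-≤ (s ==_) n (A ++ A) fits)
    (≤-reflexive (trans (count-++ (s ==_) A A) (cong₂ _+_ (once s) (once s))))

dyadic-bracket : ∀ n → 1 ≤ n → ∃ λ k → 2 ^ k ≤ n × n ≤ 2 ^ suc k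
dyadic-bracket (suc zero) _ = 0 , s≤s z≤n , s≤s z≤n
dyadic-bracket (suc (suc n)) _ with dyadic-bracket (suc n) (s≤s z≤n)
... | k , lo , hi with m≤n⇒m<n∨m≡n hi
...   | inj₁ below = k , m≤n⇒m≤1+n lo , below
...   | inj₂ top = suc k , subst (_≤ suc (suc n)) top (n≤1+n (suc n)) , hi′
  where
  open ≤-Reasoning
  hi′ : suc (suc n) ≤ 2 ^ suc (suc k)
  hi′ = begin
    suc (suc n)           ≤⟨ s≤s (m≤n+m (suc n) n) ⟩
    suc n + suc n         ≡⟨ cong₂ _+_ top top ⟩
    2 ^ suc k + 2 ^ suc k ≡⟨ sym (2^suc (suc k)) ⟩
    2 ^ suc (suc k)       ∎

lemma2p1 : (n : ℕ) → 1 ≤ n → Σ (Subset n) (λ S → ((v : Vertex n) → (v ∈S S) ⊎ ∃ (λ u → u ∈S S × Adj v u)) × ((v : Vertex n) → countAdjIn S v ≤ 2))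
lemma2p1 n 1≤n with dyadic-bracket n 1≤n
... | k , lo , hi with balanced-labelling k n lo hi
...   | L , at-least-once , at-most-twice =
  codewords L 0⃗ ,
  (λ v → inj₂ (codewords-dominate L at-least-once 0⃗ v)) ,
  codewords-sparse L at-most-twice 0⃗
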